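{- Let $G$ be a regular digraph of degree $d$ with a factorization $F_1,\dots,F_d$, let $W$ be a finite set of words, and suppose a schedule for $W$ is given. For each vertex $v$ and each nonempty $\omega\in W$, label the $k$-th edge of the path $v\omega$ with the time assigned to the $k$-th symbol occurrence of $\omega$. Then whenever two distinct pairs (vertex $v$, symbol occurrence in a word of $W$) traverse the same edge of $G$, they carry different times; that is, no edge of $G$ is assigned the same time twice. In particular, if the factorization is spanning with word set $W$, then for every two distinct vertices $u,v$ there is a directed path from $u$ to $v$ (namely $u\omega$ for some $\omega\in W$) whose time labels are increasing, and among all these paths no edge is labeled with the same time twice.
   Context: A regular digraph of degree $d$: finite vertex set, directed edges (multiple edges allowed, no loops), every vertex with in- and out-degree $d$, strongly connected. A factorization is a decomposition of the edges into disjoint $F_1,\dots,F_d$ such that each vertex is the tail of exactly one and the head of exactly one edge of each $F_i$. A word is a finite string over $\{F_1,\dots,F_d\}$; $v\omega$ is the directed path (and its endpoint) from $v$ following, for each successive symbol $F_i$, the unique edge of $F_i$ leaving the current vertex. The factorization is spanning (for a graph with $n$ vertices) with word set $W$ if $W$ consists of $n$ words including the empty word and for every vertex $v$ the vertices $v\omega$, $\omega\in W$, are pairwise distinct. A schedule for $W$ is an assignment of a positive integer time to each occurrence of each symbol in the words of $W$ such that no time is assigned to two different occurrences of the same symbol $F_i$, and the times assigned along each single word are strictly increasing. -}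

module Defs where

open import Data.Nat using (ℕ; zero; suc; _<_; _≤_)
open import Data.Fin using (Fin; zero; suc) renaming (_<_ to _<ᶠ_)
open import Data.Fin.Properties using (_≟_)
open import Data.List using (List; []; _∷_; length; lookup; filter; allFin)
open import Data.Product using (Σ; Σ-syntax; _×_; _,_; proj₁; proj₂)
open import Relation.Binary.PropositionalEquality using (_≡_; _≢_)
open import Relation.Nullary using (¬_)

-- A finite directed multigraph: vertices Fin n, edges Fin m (so parallel
-- edges are allowed), each edge with a tail and a head.
record Digraph : Set where
  field
    n    : ℕ
    m    : ℕ
    tail : Fin m → Fin n
    head : Fin m → Fin n
open Digraph public

module _ (G : Digraph) where

  Vertex : Set
  Vertex = Fin (n G)

  Edge : Set
  Edge = Fin (m G)

  NoLoops : Set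
  NoLoops = ∀ (e : Edge) → tail G e ≢ head G e

  outdeg indeg : Vertex → ℕ
  outdeg v = length (filter (λ e → tail G e ≟ v) (allFin (m G)))
  indeg  v = length (filter (λ e → head G e ≟ v) (allFin (m G)))

  data Walk : Vertex → Vertex → Set where
    nil  : ∀ {u} → Walk u u
    cons : ∀ {u v} (e : Edge) → tail G e ≡ u → Walk (head G e) v → Walk u v

  StronglyConnected : Set
  StronglyConnected = ∀ (u v : Vertex) → Walk u v

  RegularDigraph : ℕ → Set
  RegularDigraph d = NoLoops × (∀ v → outdeg v ≡ d × indeg v ≡ d) × StronglyConnected

  -- A factorization F₁,…,F_d: each edge gets exactly one class (colour),
  -- and every vertex is the tail of exactly one and the head of exactly
  -- one edge of each class.
  record Factorization (d : ℕ) : Set where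
    field
      colour     : Edge → Fin d
      out        : (v : Vertex) (i : Fin d) → Σ[ e ∈ Edge ] (colour e ≡ i × tail G e ≡ v)
      out-unique : (v : Vertex) (i : Fin d) (e : Edge) →
                   colour e ≡ i → tail G e ≡ v → e ≡ proj₁ (out v i)
      inn        : (v : Vertex) (i : Fin d) → Σ[ e ∈ Edge ] (colour e ≡ i × head G e ≡ v)
      inn-unique : (v : Vertex) (i : Fin d) (e : Edge) →
                   colour e ≡ i → head G e ≡ v → e ≡ proj₁ (inn v i)

  module _ {d : ℕ} (F : Factorization d) where
    open Factorization F

    Word : Set
    Word = List (Fin d)

    step : Vertex → Fin d → Edge
    step v i = proj₁ (out v i)

    endpoint : Vertex → Word → Vertex
    endpoint v []      = v
    endpoint v (i ∷ ω) = endpoint (head G (step v i)) ω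

    edgeAt : (v : Vertex) (ω : Word) → Fin (length ω) → Edge
    edgeAt v (i ∷ ω) zero    = step v i
    edgeAt v (i ∷ ω) (suc k) = edgeAt (head G (step v i)) ω k

    Spanning : List Word → Set
    Spanning W = length W ≡ n G
               × Σ[ j ∈ Fin (length W) ] lookup W j ≡ []
               × (∀ (v : Vertex) (j j' : Fin (length W)) →
                    endpoint v (lookup W j) ≡ endpoint v (lookup W j') → j ≡ j')

-- symbol occurrences in a list of words: (index of word, position in it)
Occ : {d : ℕ} → List (List (Fin d)) → Set
Occ W = Σ[ j ∈ Fin (length W) ] Fin (length (lookup W j))

symbolAt : {d : ℕ} (W : List (List (Fin d))) → Occ W → Fin d
symbolAt W (j , k) = lookup (lookup W j) k

Schedule : {d : ℕ} (W : List (List (Fin d))) → (Occ W → ℕ) → Set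
Schedule W τ =
    (∀ o → 1 ≤ τ o)
  × (∀ o o' → symbolAt W o ≡ symbolAt W o' → τ o ≡ τ o' → o ≡ o')
  × (∀ j (k k' : Fin (length (lookup W j))) → k <ᶠ k' → τ (j , k) < τ (j , k'))

-- A factorization makes each "colour-i step" v ↦ head (step v i) a permutation
-- of the vertices, so the k-th edge of vω determines v once ω and k are fixed,
-- and its colour is the k-th symbol of ω. Hence two traversals of one edge at
-- one time carry the same symbol at the same time; the schedule forces them to
-- be the same occurrence, and then the same start vertex. For a spanning
-- factorization, ω ↦ uω is injective from the n words of W into the n vertices,
-- hence onto, and every word is scheduled with increasing times.
module Submission where

open import Defs
open import Data.Nat using (ℕ; suc; _<_; _≤_)
open import Data.Nat.Properties using (≤-reflexive; ≤-trans; 1+n≰n)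
open import Data.Fin using (Fin; zero; suc; punchOut) renaming (_<_ to _<ᶠ_)
open import Data.Fin.Properties using (any?; punchOut-injective; injective⇒≤)
  renaming (_≟_ to _≟ᶠ_)
open import Data.List using (List; length; lookup; _∷_)
open import Data.List.Relation.Unary.Unique.Propositional using (Unique)
open import Data.Product using (Σ; Σ-syntax; ∃; _×_; _,_; proj₁; proj₂)
open import Data.Empty using (⊥-elim)
open import Function.Definitions using (Injective)
open import Relation.Binary.PropositionalEquality
  using (_≡_; _≢_; refl; sym; trans; cong; module ≡-Reasoning)
open import Relation.Nullary using (yes; no)

-- A missed value y could be punched out, giving an injection into Fin (n - 1).
injective⇒surjective : ∀ {m n} → n ≤ m → (f : Fin m → Fin n) →
                       Injective _≡_ _≡_ f → ∀ y → ∃ λ x → f x ≡ y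
injective⇒surjective {n = suc n} n≤m f f-inj y with any? (λ x → f x ≟ᶠ y)
... | yes hit  = hit
... | no  miss = ⊥-elim (1+n≰n (≤-trans n≤m (injective⇒≤ f∖y-inj)))
  where
  y≢f : ∀ x → y ≢ f x
  y≢f x y≡fx = miss (x , sym y≡fx)

  f∖y : Fin _ → Fin n
  f∖y x = punchOut (y≢f x)

  f∖y-inj : Injective _≡_ _≡_ f∖y
  f∖y-inj {x} {x'} eq = f-inj (punchOut-injective (y≢f x) (y≢f x') eq)

module _ (G : Digraph) {d : ℕ} (F : Factorization G d) where
  open Factorization F

  step-colour : ∀ v i → colour (step G F v i) ≡ i
  step-colour v i = proj₁ (proj₂ (out v i))

  step-tail : ∀ v i → tail G (step G F v i) ≡ v
  step-tail v i = proj₂ (proj₂ (out v i))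

  colour-edgeAt : ∀ v (ω : Word G F) k → colour (edgeAt G F v ω k) ≡ lookup ω k
  colour-edgeAt v (i ∷ ω) zero    = step-colour v i
  colour-edgeAt v (i ∷ ω) (suc k) = colour-edgeAt _ ω k

  head-step-injective : ∀ i → Injective _≡_ _≡_ (λ v → head G (step G F v i))
  head-step-injective i {v} {v'} heads≡ = begin
    v                          ≡⟨ sym (step-tail v i) ⟩
    tail G (step G F v i)      ≡⟨ cong (tail G) steps≡ ⟩
    tail G (step G F v' i)     ≡⟨ step-tail v' i ⟩
    v'                         ∎
    where
    open ≡-Reasoning
    steps≡ : step G F v i ≡ step G F v' i
    steps≡ = trans (inn-unique _ i _ (step-colour v i) refl)
                   (sym (inn-unique _ i _ (step-colour v' i) (sym heads≡)))

  edgeAt-injective : ∀ (ω : Word G F) k → Injective _≡_ _≡_ (λ v → edgeAt G F v ω k)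
  edgeAt-injective (i ∷ ω) zero    eq = head-step-injective i (cong (head G) eq)
  edgeAt-injective (i ∷ ω) (suc k) eq = head-step-injective i (edgeAt-injective ω k eq)

  module _ (W : List (Word G F)) (τ : Occ W → ℕ) where

    traversal : Vertex G → Occ W → Edge G
    traversal v (j , k) = edgeAt G F v (lookup W j) k

    traversal-colour : ∀ v o → colour (traversal v o) ≡ symbolAt W o
    traversal-colour v (j , k) = colour-edgeAt v (lookup W j) k

    shared-edge⇒distinct-times :
      (∀ o o' → symbolAt W o ≡ symbolAt W o' → τ o ≡ τ o' → o ≡ o') →
      ∀ v v' o o' → (v , o) ≢ (v' , o') →
      traversal v o ≡ traversal v' o' → τ o ≢ τ o'
    shared-edge⇒distinct-times τ-inj v v' o o' pairs≢ edges≡ times≡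
      with τ-inj o o' symbols≡ times≡
      where
      symbols≡ : symbolAt W o ≡ symbolAt W o'
      symbols≡ = trans (sym (traversal-colour v o))
                       (trans (cong colour edges≡) (traversal-colour v' o'))
    shared-edge⇒distinct-times _ v v' (j , k) _ pairs≢ edges≡ _ | refl =
      pairs≢ (cong (_, (j , k)) (edgeAt-injective (lookup W j) k edges≡))

    spanning⇒scheduled-paths :
      (∀ j (k k' : Fin (length (lookup W j))) → k <ᶠ k' → τ (j , k) < τ (j , k')) →
      Spanning G F W → ∀ u v →
      Σ[ j ∈ Fin (length W) ]
        (endpoint G F u (lookup W j) ≡ v
        × (∀ (k k' : Fin (length (lookup W j))) → k <ᶠ k' → τ (j , k) < τ (j , k')))
    spanning⇒scheduled-paths τ-mono (|W|≡n , _ , _ , endpoints-inj) u v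
      with j , uωⱼ≡v ← injective⇒surjective (≤-reflexive (sym |W|≡n))
                         (λ j → endpoint G F u (lookup W j)) (endpoints-inj u _ _) v
      = j , uωⱼ≡v , τ-mono j

fact2 : (G : Digraph) (d : ℕ) → RegularDigraph G d → (F : Factorization G d) →
        (W : List (List (Fin d))) → Unique W →
        (τ : Occ W → ℕ) → Schedule W τ →
        (∀ (v v' : Vertex G) (o o' : Occ W) → (v , o) ≢ (v' , o') →
           edgeAt G F v (lookup W (Σ.proj₁ o)) (Σ.proj₂ o)
             ≡ edgeAt G F v' (lookup W (Σ.proj₁ o')) (Σ.proj₂ o') →
           τ o ≢ τ o')
        × (Spanning G F W →
           ∀ (u v : Vertex G) → u ≢ v →
             Σ[ j ∈ Fin (length W) ]
               (endpoint G F u (lookup W j) ≡ v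
               × (∀ (k k' : Fin (length (lookup W j))) → k <ᶠ k' → τ (j , k) < τ (j , k'))))
fact2 G d _ F W _ τ (_ , τ-inj , τ-mono) =
    shared-edge⇒distinct-times G F W τ τ-inj
  , λ spanning u v _ → spanning⇒scheduled-paths G F W τ τ-mono spanning u v
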